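{- Let $G$ be a finite simple graph with no isolated vertices. Then $B(G)\leq Z(L(G))$.
   Context: For a finite simple graph $H$: colour each vertex black or white. A black vertex $v$ may force a white neighbour $w$ to become black if $w$ is the only white neighbour of $v$. A set $S\subseteq V(H)$ is a zero-forcing set if, colouring exactly the vertices of $S$ black and repeatedly applying this rule, all vertices eventually become black. The zero-forcing number $Z(H)$ is the minimum size of a zero-forcing set (and $Z$ of the graph with no vertices is $0$). Brushing: initially every vertex and every edge of $G$ is dirty. An initial configuration places a nonnegative integer number of brushes at each vertex. At each step a single remaining vertex $v$ fires; $v$ may fire only if the number of brushes currently at $v$ is at least the number of dirty edges currently incident with $v$. When $v$ fires, $v$ becomes clean, and each dirty edge incident with $v$ is traversed by at least one brush (distinct brushes for distinct edges; several brushes may traverse the same edge), which cleans that edge and moves those brushes to its other endpoint; excess brushes may remain at $v$ but play no further role; $v$ and its incident edges are then removed. The process ends when no vertex can fire. A configuration cleans $G$ if some such process cleans all vertices and edges. $B(G)$ is the minimum total number of brushes in a configuration that cleans $G$. $L(G)$ denotes the line graph of $G$: its vertices are the edges of $G$, two being adjacent iff they share an endpoint in $G$. -}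

module Defs where

open import Data.Bool using (Bool; true; false; _∧_; _∨_; T)
open import Data.Nat using (ℕ; zero; suc; _+_; _≤_; _<ᵇ_)
open import Data.Fin using (Fin; toℕ)
open import Data.Fin.Subset using (Subset; _∈_; _∉_; ∣_∣; ⊤; ⊥; ⁅_⁆; _∪_; _∩_; _-_)
open import Data.Vec using (Vec; lookup; tabulate; zipWith; sum)
import Data.List as List
open import Data.List using (List; filterᵇ; cartesianProduct; allFin)
open import Data.Product using (Σ; ∃; ∃-syntax; _×_; _,_; proj₁; proj₂)
open import Relation.Binary.PropositionalEquality using (_≡_; _≢_)
open import Relation.Binary.Construct.Closure.ReflexiveTransitive using (Star)
open import Relation.Nullary.Decidable using (⌊_⌋)
import Data.Fin as Fin

record Graph (n : ℕ) : Set where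
  field
    adj    : Fin n → Fin n → Bool
    sym    : ∀ i j → adj i j ≡ adj j i
    irrefl : ∀ i → adj i i ≡ false

open Graph public

NoIsolatedVertices : ∀ {n} → Graph n → Set
NoIsolatedVertices {n} G = ∀ (v : Fin n) → ∃[ u ] (adj G v u ≡ true)

nbhd : ∀ {n} → (Fin n → Fin n → Bool) → Fin n → Subset n
nbhd a v = tabulate (a v)

ForceStep : ∀ {n} → (Fin n → Fin n → Bool) → Subset n → Subset n → Set
ForceStep {n} a B B' =
  Σ (Fin n) λ v → Σ (Fin n) λ w →
    v ∈ B × w ∉ B × a v w ≡ true
    × (∀ (u : Fin n) → a v u ≡ true → u ≢ w → u ∈ B)
    × B' ≡ B ∪ ⁅ w ⁆

IsZeroForcingSet : ∀ {n} → (Fin n → Fin n → Bool) → Subset n → Set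
IsZeroForcingSet a S = Star (ForceStep a) S ⊤

IsZeroForcingNumber : ∀ {n} → (Fin n → Fin n → Bool) → ℕ → Set
IsZeroForcingNumber {n} a k =
  (Σ (Subset n) λ S → IsZeroForcingSet a S × ∣ S ∣ ≡ k)
  × (∀ (S : Subset n) → IsZeroForcingSet a S → k ≤ ∣ S ∣)

edges : ∀ {n} → Graph n → List (Fin n × Fin n)
edges {n} G =
  filterᵇ (λ p → (toℕ (proj₁ p) <ᵇ toℕ (proj₂ p)) ∧ adj G (proj₁ p) (proj₂ p))
          (cartesianProduct (allFin n) (allFin n))

numEdges : ∀ {n} → Graph n → ℕ
numEdges G = List.length (edges G)

edgeAt : ∀ {n} (G : Graph n) → Fin (numEdges G) → Fin n × Fin n
edgeAt G k = List.lookup (edges G) k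

_==_ : ∀ {n} → Fin n → Fin n → Bool
i == j = ⌊ i Fin.≟ j ⌋

shareEndpoint : ∀ {n} → Fin n × Fin n → Fin n × Fin n → Bool
shareEndpoint (a , b) (c , d) = (a == c) ∨ (a == d) ∨ (b == c) ∨ (b == d)

lineAdj : ∀ {n} (G : Graph n) → Fin (numEdges G) → Fin (numEdges G) → Bool
lineAdj G k l = Data.Bool.not (k == l) ∧ shareEndpoint (edgeAt G k) (edgeAt G l)
  where import Data.Bool

-- A state is (R , b): R = set of vertices not yet fired,
-- b = current number of brushes at each vertex. An edge is dirty iff
-- both endpoints are still in R (edges are cleaned exactly when an
-- endpoint fires), so the dirty degree of v is ∣ R ∩ N(v) ∣.

BrushState : ℕ → Set
BrushState n = Subset n × Vec ℕ n

dirtyDegree : ∀ {n} → Graph n → Subset n → Fin n → ℕ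
dirtyDegree G R v = ∣ R ∩ nbhd (adj G) v ∣

Fire : ∀ {n} → Graph n → BrushState n → BrushState n → Set
Fire {n} G (R , b) (R' , b') =
  Σ (Fin n) λ v → v ∈ R × dirtyDegree G R v ≤ lookup b v
    × Σ (Vec ℕ n) λ f →
        (∀ (u : Fin n) → u ∈ R → adj G v u ≡ true → 1 ≤ lookup f u)
      × (∀ (u : Fin n) → lookup f u ≢ 0 → u ∈ R × adj G v u ≡ true)
      × sum f ≤ lookup b v
      × R' ≡ R - v
      × b' ≡ zipWith _+_ b f

-- A configuration cleans G if some firing sequence fires every vertex
-- (then every edge is clean as well).
Cleans : ∀ {n} → Graph n → Vec ℕ n → Set
Cleans {n} G c = Σ (Vec ℕ n) λ b → Star (Fire G) (⊤ , c) (⊥ , b)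

IsBrushingNumber : ∀ {n} → Graph n → ℕ → Set
IsBrushingNumber {n} G k =
  (Σ (Vec ℕ n) λ c → Cleans G c × sum c ≡ k)
  × (∀ (c : Vec ℕ n) → Cleans G c → k ≤ sum c)

module Submission where

-- Fix a zero-forcing set S of L(G) and replay its forcing chronology, colouring edges of G
-- black as they are forced, while firing vertices of G. The brushing state keeps two
-- invariants: every dirty black edge lies in S, and every unfired vertex adjacent to a fired
-- one holds a brush. After each force, every vertex whose edges are all black is fired; its
-- dirty edges are black, hence in S, and each gets one new brush. When e forces f at their
-- common endpoint x, the other endpoint u of e has only black edges, so u has already fired
-- and left a brush at x; x then fires with new brushes only for its dirty edges other than f,
-- which are black and thus in S. Every edge of S is paid for at most once, since it is clean
-- afterwards, so at most |S| brushes are placed; once every edge is black, every vertex has fired.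

open import Algebra.Properties.CommutativeSemigroup
open import Data.Bool using (Bool; true; false; _∧_; if_then_else_; T)
open import Data.Bool.Properties using (T-≡; T-∧; ∧-conicalˡ; ∧-conicalʳ)
open import Data.Empty using (⊥-elim)
open import Data.Fin as Fin using (Fin; zero; suc; toℕ)
open import Data.Fin.Properties using (0≢1+n; suc-injective; toℕ-injective; any?; all?)
open import Data.Fin.Subset using (Subset; _∈_; _∉_; _⊆_; ∣_∣; ⊤; ⊥; ⁅_⁆; _∩_; _∪_; _─_; _-_)
open import Data.Fin.Subset.Properties
  using ( _∈?_; ∈⊤; Empty-unique; x∈⁅y⁆⇒x≡y; ∣⁅x⁆∣≡1; x∈p∩q⁺; x∈p∩q⁻; x∈p∪q⁻; x∈p∧x∉q⇒x∈p─q
        ; x∈p∧x≢y⇒x∈p-y; p─q⊆p; p⊆q⇒∣p∣≤∣q∣; ∣p∩q∣≤∣p∣; ∣p∩q∣≤∣q∣; x∈p⇒∣p-x∣<∣p∣)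
open import Data.List as List using (List; cartesianProduct; allFin)
open import Data.List.Membership.Propositional.Properties
  using (∈-lookup; ∈-filter⁻; ∈-filter⁺; ∈-cartesianProduct⁺; ∈-allFin)
import Data.List.Relation.Unary.All as All
open import Data.List.Relation.Unary.AllPairs using (_∷_)
open import Data.List.Relation.Unary.Any using (index)
open import Data.List.Relation.Unary.Any.Properties using (lookup-index)
open import Data.List.Relation.Unary.Unique.Propositional using (Unique)
import Data.List.Relation.Unary.Unique.Propositional.Properties as Unique
open import Data.Nat using (ℕ; zero; suc; _+_; _≤_; _<_; z≤n; s≤s; _<ᵇ_)
open import Data.Nat.Induction using (<-wellFounded)
open import Data.Nat.Properties
  using ( +-assoc; +-comm; +-suc; +-identityˡ; +-identityʳ; +-commutativeSemigroup
        ; +-mono-≤; +-monoˡ-≤; +-monoʳ-≤; m≤m+n; m≤n+m; ≤-trans; ≤-reflexive; module ≤-Reasoning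
        ; <ᵇ⇒<; <⇒<ᵇ; <-cmp; <-asym; <-irrefl)
open import Data.Product using (Σ; ∃-syntax; _×_; _,_; proj₁; proj₂)
open import Data.Sum using (_⊎_; inj₁; inj₂; swap; [_,_])
open import Data.Vec
  using (Vec; []; _∷_; lookup; tabulate; zipWith; map; replicate; sum; _[_]≔_; here; there)
open import Data.Vec.Properties
  using (lookup-zipWith; lookup∘update; lookup∘tabulate; lookup⇒[]=; []=⇒lookup
        ; zipWith-assoc; zipWith-identityˡ)
open import Function using (_∘_)
open import Function.Bundles using (Equivalence)
open import Induction.WellFounded using (Acc; acc)
open import Relation.Binary.Construct.Closure.ReflexiveTransitive using (Star; ε; _◅_)
open import Relation.Binary.Definitions using (tri<; tri≈; tri>)
open import Relation.Binary.PropositionalEquality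
  using (_≡_; _≢_; refl; sym; trans; cong; cong₂; subst; module ≡-Reasoning)
open import Relation.Nullary using (Dec; yes; no)
open import Relation.Nullary.Decidable
  using (T?; toWitnessFalse; fromWitnessFalse; _×-dec_; _⊎-dec_; _→-dec_)

open import Defs hiding (sym)

private variable
  n m : ℕ

∈-tabulate⁺ : ∀ {f : Fin n → Bool} {i} → f i ≡ true → i ∈ tabulate f
∈-tabulate⁺ {f = f} {i} fi≡true = lookup⇒[]= i (tabulate f) (trans (lookup∘tabulate f i) fi≡true)

∈-tabulate⁻ : ∀ {f : Fin n → Bool} {i} → i ∈ tabulate f → f i ≡ true
∈-tabulate⁻ {f = f} {i} i∈f = trans (sym (lookup∘tabulate f i)) ([]=⇒lookup i∈f)

x∉p-x : (p : Subset n) (x : Fin n) → x ∉ p - x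
x∉p-x (_ ∷ p) zero    ()
x∉p-x (_ ∷ p) (suc x) (there x∈p-x) = x∉p-x p x x∈p-x

∣p∣≡∣p∩q∣+∣p─q∣ : (p q : Subset n) → ∣ p ∣ ≡ ∣ p ∩ q ∣ + ∣ p ─ q ∣
∣p∣≡∣p∩q∣+∣p─q∣ []          []          = refl
∣p∣≡∣p∩q∣+∣p─q∣ (true ∷ p)  (true ∷ q)  = cong suc (∣p∣≡∣p∩q∣+∣p─q∣ p q)
∣p∣≡∣p∩q∣+∣p─q∣ (true ∷ p)  (false ∷ q) = trans (cong suc (∣p∣≡∣p∩q∣+∣p─q∣ p q)) (sym (+-suc _ _))
∣p∣≡∣p∩q∣+∣p─q∣ (false ∷ p) (true ∷ q)  = ∣p∣≡∣p∩q∣+∣p─q∣ p q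
∣p∣≡∣p∩q∣+∣p─q∣ (false ∷ p) (false ∷ q) = ∣p∣≡∣p∩q∣+∣p─q∣ p q

∣p∣≤1+∣p-x∣ : (p : Subset n) (x : Fin n) → ∣ p ∣ ≤ suc ∣ p - x ∣
∣p∣≤1+∣p-x∣ p x = begin
  ∣ p ∣                      ≡⟨ ∣p∣≡∣p∩q∣+∣p─q∣ p ⁅ x ⁆ ⟩
  ∣ p ∩ ⁅ x ⁆ ∣ + ∣ p - x ∣  ≤⟨ +-monoˡ-≤ _ (≤-trans (∣p∩q∣≤∣q∣ p ⁅ x ⁆) (≤-reflexive (∣⁅x⁆∣≡1 x))) ⟩
  suc ∣ p - x ∣              ∎
  where open ≤-Reasoning

matching⇒∣p∣≤∣q∣ : ∀ {p : Subset n} {q : Subset m} (_~_ : Fin n → Fin m → Set) →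
  (∀ {i} → i ∈ p → ∃[ j ] j ∈ q × i ~ j) →
  (∀ {i i′ j} → i ∈ p → i′ ∈ p → i ~ j → i′ ~ j → i ≡ i′) →
  ∣ p ∣ ≤ ∣ q ∣
matching⇒∣p∣≤∣q∣ {p = []} _ _ _ = z≤n
matching⇒∣p∣≤∣q∣ {p = false ∷ p} _~_ match unique =
  matching⇒∣p∣≤∣q∣ (λ i → suc i ~_) (match ∘ there)
    (λ i∈p i′∈p i~j i′~j → suc-injective (unique (there i∈p) (there i′∈p) i~j i′~j))
matching⇒∣p∣≤∣q∣ {p = true ∷ p} {q = q} _~_ match unique with match here
... | j , j∈q , 0~j = ≤-trans (s≤s ∣p∣≤∣q-j∣) (x∈p⇒∣p-x∣<∣p∣ j∈q)
  where
  match′ : ∀ {i} → i ∈ p → ∃[ j′ ] j′ ∈ q - j × suc i ~ j′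
  match′ i∈p with match (there i∈p)
  ... | j′ , j′∈q , i~j′ =
    j′ , x∈p∧x≢y⇒x∈p-y j′∈q (λ { refl → 0≢1+n (unique here (there i∈p) 0~j i~j′) }) , i~j′

  ∣p∣≤∣q-j∣ : ∣ p ∣ ≤ ∣ q - j ∣
  ∣p∣≤∣q-j∣ = matching⇒∣p∣≤∣q∣ (λ i → suc i ~_) match′
    (λ i∈p i′∈p i~j i′~j → suc-injective (unique (there i∈p) (there i′∈p) i~j i′~j))

infixl 6 _⊕_
_⊕_ : Vec ℕ n → Vec ℕ n → Vec ℕ n
_⊕_ = zipWith _+_

⊕-assoc : (u v w : Vec ℕ n) → (u ⊕ v) ⊕ w ≡ u ⊕ (v ⊕ w)
⊕-assoc = zipWith-assoc +-assoc

⊕-swap : (u v w : Vec ℕ n) → (u ⊕ v) ⊕ w ≡ (u ⊕ w) ⊕ v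
⊕-swap []      []      []      = refl
⊕-swap (x ∷ u) (y ∷ v) (z ∷ w) =
  cong₂ _∷_ (xy∙z≈xz∙y +-commutativeSemigroup x y z) (⊕-swap u v w)

⊕-rearrange : (b f d s : Vec ℕ n) → ((b ⊕ f) ⊕ d) ⊕ s ≡ (b ⊕ (d ⊕ s)) ⊕ f
⊕-rearrange b f d s = begin
  ((b ⊕ f) ⊕ d) ⊕ s    ≡⟨ cong (_⊕ s) (⊕-swap b f d) ⟩
  ((b ⊕ d) ⊕ f) ⊕ s    ≡⟨ ⊕-swap (b ⊕ d) f s ⟩
  ((b ⊕ d) ⊕ s) ⊕ f    ≡⟨ cong (_⊕ f) (⊕-assoc b d s) ⟩
  (b ⊕ (d ⊕ s)) ⊕ f    ∎
  where open ≡-Reasoning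

lookup-⊕ : (u v : Vec ℕ n) (i : Fin n) → lookup (u ⊕ v) i ≡ lookup u i + lookup v i
lookup-⊕ u v i = lookup-zipWith _+_ i u v

lookup≤lookup-⊕ˡ : (u v : Vec ℕ n) (i : Fin n) → lookup u i ≤ lookup (u ⊕ v) i
lookup≤lookup-⊕ˡ u v i = ≤-trans (m≤m+n _ _) (≤-reflexive (sym (lookup-⊕ u v i)))

lookup≤lookup-⊕ʳ : (u v : Vec ℕ n) (i : Fin n) → lookup v i ≤ lookup (u ⊕ v) i
lookup≤lookup-⊕ʳ u v i = ≤-trans (m≤n+m _ _) (≤-reflexive (sym (lookup-⊕ u v i)))

sum-⊕ : (u v : Vec ℕ n) → sum (u ⊕ v) ≡ sum u + sum v
sum-⊕ []      []      = refl
sum-⊕ (x ∷ u) (y ∷ v) =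
  trans (cong (x + y +_) (sum-⊕ u v)) (interchange +-commutativeSemigroup x y (sum u) (sum v))

sum-replicate-0 : sum (replicate n 0) ≡ 0
sum-replicate-0 {zero}  = refl
sum-replicate-0 {suc n} = sum-replicate-0 {n}

single : Fin n → ℕ → Vec ℕ n
single x a = replicate _ 0 [ x ]≔ a

sum-single : (x : Fin n) (a : ℕ) → sum (single x a) ≡ a
sum-single {suc n} zero    a = trans (cong (a +_) (sum-replicate-0 {n})) (+-identityʳ a)
sum-single         (suc x) a = sum-single x a

indicator : Subset n → Vec ℕ n
indicator = map (λ s → if s then 1 else 0)

sum-indicator : (p : Subset n) → sum (indicator p) ≡ ∣ p ∣
sum-indicator []          = refl
sum-indicator (true ∷ p)  = cong suc (sum-indicator p)
sum-indicator (false ∷ p) = sum-indicator p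

lookup-indicator-∈ : ∀ {p : Subset n} {i} → i ∈ p → lookup (indicator p) i ≡ 1
lookup-indicator-∈ here        = refl
lookup-indicator-∈ (there i∈p) = lookup-indicator-∈ i∈p

lookup-indicator-≢0 : ∀ (p : Subset n) i → lookup (indicator p) i ≢ 0 → i ∈ p
lookup-indicator-≢0 (true ∷ p)  zero    _   = here
lookup-indicator-≢0 (false ∷ p) zero    ≢0  = ⊥-elim (≢0 refl)
lookup-indicator-≢0 (_ ∷ p)     (suc i) ≢0  = there (lookup-indicator-≢0 p i ≢0)

unique⇒lookup-injective : ∀ {a} {A : Set a} {xs : List A} → Unique xs →
  ∀ i j → List.lookup xs i ≡ List.lookup xs j → i ≡ j
unique⇒lookup-injective (_ ∷ _)      zero    zero    _  = refl
unique⇒lookup-injective (x∉xs ∷ _)   zero    (suc j) eq = ⊥-elim (All.lookup x∉xs (∈-lookup j) eq)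
unique⇒lookup-injective (x∉xs ∷ _)   (suc i) zero    eq = ⊥-elim (All.lookup x∉xs (∈-lookup i) (sym eq))
unique⇒lookup-injective (_ ∷ unique) (suc i) (suc j) eq =
  cong suc (unique⇒lookup-injective unique i j eq)

shareEndpoint⇒ : ∀ {a b c d : Fin n} → T (shareEndpoint (a , b) (c , d)) →
  ∃[ x ] (x ≡ a ⊎ x ≡ b) × (x ≡ c ⊎ x ≡ d)
shareEndpoint⇒ {a = a} {b} {c} {d} _ with a Fin.≟ c | a Fin.≟ d | b Fin.≟ c | b Fin.≟ d
... | yes a≡c | _       | _       | _       = a , inj₁ refl , inj₁ a≡c
... | no _    | yes a≡d | _       | _       = a , inj₁ refl , inj₂ a≡d
... | no _    | no _    | yes b≡c | _       = b , inj₂ refl , inj₁ b≡c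
... | no _    | no _    | no _    | yes b≡d = b , inj₂ refl , inj₂ b≡d

shareEndpoint⇐ : ∀ {a b c d x : Fin n} → x ≡ a ⊎ x ≡ b → x ≡ c ⊎ x ≡ d →
  T (shareEndpoint (a , b) (c , d))
shareEndpoint⇐ {a = a} {b} {c} {d} xab xcd with a Fin.≟ c | a Fin.≟ d | b Fin.≟ c | b Fin.≟ d
... | yes _  | _      | _      | _      = _
... | no _   | yes _  | _      | _      = _
... | no _   | no _   | yes _  | _      = _
... | no _   | no _   | no _   | yes _  = _
... | no a≢c | no a≢d | no b≢c | no b≢d with xab | xcd
...   | inj₁ refl | inj₁ refl = a≢c refl
...   | inj₁ refl | inj₂ refl = a≢d refl
...   | inj₂ refl | inj₁ refl = b≢c refl
...   | inj₂ refl | inj₂ refl = b≢d refl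

module Edges {n} (G : Graph n) where

  source target : Fin (numEdges G) → Fin n
  source k = proj₁ (edgeAt G k)
  target k = proj₂ (edgeAt G k)

  infix 4 _∈ᵉ_
  _∈ᵉ_ : Fin n → Fin (numEdges G) → Set
  v ∈ᵉ k = v ≡ source k ⊎ v ≡ target k

  private
    IsEdge : Fin n × Fin n → Bool
    IsEdge p = (toℕ (proj₁ p) <ᵇ toℕ (proj₂ p)) ∧ adj G (proj₁ p) (proj₂ p)

    edgeAt-isEdge : ∀ k → T (IsEdge (edgeAt G k))
    edgeAt-isEdge k = proj₂ (∈-filter⁻ (T? ∘ IsEdge) {xs = cartesianProduct (allFin n) (allFin n)}
                                       (∈-lookup {xs = edges G} k))

  source<target : ∀ k → toℕ (source k) < toℕ (target k)
  source<target k = <ᵇ⇒< _ _ (proj₁ (Equivalence.to T-∧ (edgeAt-isEdge k)))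

  adj-source-target : ∀ k → adj G (source k) (target k) ≡ true
  adj-source-target k = Equivalence.to T-≡ (proj₂ (Equivalence.to T-∧ (edgeAt-isEdge k)))

  edgeAt-complete : ∀ {x y} → toℕ x < toℕ y → adj G x y ≡ true → ∃[ k ] edgeAt G k ≡ (x , y)
  edgeAt-complete {x} {y} x<y xy = index xy∈edges , sym (lookup-index xy∈edges)
    where
    xy∈edges = ∈-filter⁺ (T? ∘ IsEdge) (∈-cartesianProduct⁺ (∈-allFin x) (∈-allFin y))
                 (Equivalence.from T-∧ (<⇒<ᵇ x<y , Equivalence.from T-≡ xy))

  edgeAt-injective : ∀ {k l} → edgeAt G k ≡ edgeAt G l → k ≡ l
  edgeAt-injective = unique⇒lookup-injective
    (Unique.filter⁺ (T? ∘ IsEdge) (Unique.cartesianProduct⁺ (Unique.allFin⁺ n) (Unique.allFin⁺ n))) _ _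

  adj⇒≢ : ∀ {x y} → adj G x y ≡ true → x ≢ y
  adj⇒≢ {x} xy refl with trans (sym xy) (irrefl G x)
  ... | ()

  adj⇒edge : ∀ {x y} → adj G x y ≡ true → ∃[ k ] x ∈ᵉ k × y ∈ᵉ k
  adj⇒edge {x} {y} xy with <-cmp (toℕ x) (toℕ y)
  ... | tri< x<y _ _ with edgeAt-complete x<y xy
  ...   | k , refl = k , inj₁ refl , inj₂ refl
  adj⇒edge {x} {y} xy | tri> _ _ y<x with edgeAt-complete y<x (trans (Graph.sym G y x) xy)
  ...   | k , refl = k , inj₂ refl , inj₁ refl
  adj⇒edge {x} {y} xy | tri≈ _ x≡y _ = ⊥-elim (adj⇒≢ xy (toℕ-injective x≡y))

  ∈ᵉ-pair : ∀ {x y z k} → x ≢ y → x ∈ᵉ k → y ∈ᵉ k → z ∈ᵉ k → z ≡ x ⊎ z ≡ y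
  ∈ᵉ-pair x≢y (inj₁ refl) (inj₁ refl) _   = ⊥-elim (x≢y refl)
  ∈ᵉ-pair x≢y (inj₂ refl) (inj₂ refl) _   = ⊥-elim (x≢y refl)
  ∈ᵉ-pair _   (inj₁ refl) (inj₂ refl) z∈k = z∈k
  ∈ᵉ-pair _   (inj₂ refl) (inj₁ refl) z∈k = swap z∈k

  ∈ᵉ-other : ∀ {x k} → x ∈ᵉ k → ∃[ y ] y ∈ᵉ k × adj G x y ≡ true
  ∈ᵉ-other {k = k} (inj₁ refl) = target k , inj₂ refl , adj-source-target k
  ∈ᵉ-other {k = k} (inj₂ refl) = source k , inj₁ refl , trans (Graph.sym G _ _) (adj-source-target k)

  endpoints-ordered : ∀ {x y k} → x ∈ᵉ k → y ∈ᵉ k → toℕ x < toℕ y → source k ≡ x × target k ≡ y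
  endpoints-ordered         (inj₁ refl) (inj₂ refl) _   = refl , refl
  endpoints-ordered {k = k} (inj₂ refl) (inj₁ refl) t<s = ⊥-elim (<-asym t<s (source<target k))
  endpoints-ordered         (inj₁ refl) (inj₁ refl) x<x = ⊥-elim (<-irrefl refl x<x)
  endpoints-ordered         (inj₂ refl) (inj₂ refl) x<x = ⊥-elim (<-irrefl refl x<x)

  edge-unique-ordered : ∀ {x y k l} → toℕ x < toℕ y → x ∈ᵉ k → y ∈ᵉ k → x ∈ᵉ l → y ∈ᵉ l → k ≡ l
  edge-unique-ordered x<y xk yk xl yl
    with endpoints-ordered xk yk x<y | endpoints-ordered xl yl x<y
  ... | sk , tk | sl , tl = edgeAt-injective (cong₂ _,_ (trans sk (sym sl)) (trans tk (sym tl)))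

  edge-unique : ∀ {x y k l} → x ≢ y → x ∈ᵉ k → y ∈ᵉ k → x ∈ᵉ l → y ∈ᵉ l → k ≡ l
  edge-unique {x} {y} x≢y xk yk xl yl with <-cmp (toℕ x) (toℕ y)
  ... | tri< x<y _ _ = edge-unique-ordered x<y xk yk xl yl
  ... | tri> _ _ y<x = edge-unique-ordered y<x yk xk yl xl
  ... | tri≈ _ x≡y _ = ⊥-elim (x≢y (toℕ-injective x≡y))

  lineAdj⇒ : ∀ {e f} → lineAdj G e f ≡ true → e ≢ f × ∃[ x ] x ∈ᵉ e × x ∈ᵉ f
  lineAdj⇒ {e} {f} eLf with Equivalence.to T-∧ (Equivalence.from T-≡ eLf)
  ... | e≠f , shared = toWitnessFalse {a? = e Fin.≟ f} e≠f , shareEndpoint⇒ shared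

  ⇒lineAdj : ∀ {e f x} → e ≢ f → x ∈ᵉ e → x ∈ᵉ f → lineAdj G e f ≡ true
  ⇒lineAdj {e} {f} e≢f xe xf = Equivalence.to T-≡
    (Equivalence.from T-∧ (fromWitnessFalse {a? = e Fin.≟ f} e≢f , shareEndpoint⇐ xe xf))

module Brushing {n} (G : Graph n) where

  Cleanable : BrushState n → Set
  Cleanable s = Σ (Vec ℕ n) λ b → Star (Fire G) s (⊥ , b)

  fire-⊕ : ∀ {R b R′ b′} (c : Vec ℕ n) → Fire G (R , b) (R′ , b′) → Fire G (R , b ⊕ c) (R′ , b′ ⊕ c)
  fire-⊕ {b = b} c (v , v∈R , deg≤b , f , sends , onlyDirty , sum-f≤b , refl , refl) =
    v , v∈R , ≤-trans deg≤b (lookup≤lookup-⊕ˡ b c v) , f , sends , onlyDirty ,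
    ≤-trans sum-f≤b (lookup≤lookup-⊕ˡ b c v) , refl , ⊕-swap b f c

  reach-⊕ : ∀ {R b R′ b′} (c : Vec ℕ n) →
    Star (Fire G) (R , b) (R′ , b′) → Star (Fire G) (R , b ⊕ c) (R′ , b′ ⊕ c)
  reach-⊕ c ε              = ε
  reach-⊕ c (step ◅ steps) = fire-⊕ c step ◅ reach-⊕ c steps

  cleanable-⊕ : ∀ {R b} (c : Vec ℕ n) → Cleanable (R , b) → Cleanable (R , b ⊕ c)
  cleanable-⊕ c (b′ , steps) = b′ ⊕ c , reach-⊕ c steps

  cleanable-◅ : ∀ {s s′} → Fire G s s′ → Cleanable s′ → Cleanable s
  cleanable-◅ step (b′ , steps) = b′ , step ◅ steps

  spread : Subset n → Fin n → Vec ℕ n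
  spread R x = indicator (R ∩ nbhd (adj G) x)

  fire-spread : ∀ {R b x} → x ∈ R → dirtyDegree G R x ≤ lookup b x →
    Fire G (R , b) (R - x , b ⊕ spread R x)
  fire-spread {R} {b} {x} x∈R deg≤b =
    x , x∈R , deg≤b , spread R x , sends , onlyDirty ,
    ≤-trans (≤-reflexive (sum-indicator (R ∩ nbhd (adj G) x))) deg≤b , refl , refl
    where
    sends : ∀ u → u ∈ R → adj G x u ≡ true → 1 ≤ lookup (spread R x) u
    sends u u∈R xu = ≤-reflexive (sym (lookup-indicator-∈ (x∈p∩q⁺ (u∈R , ∈-tabulate⁺ xu))))

    onlyDirty : ∀ u → lookup (spread R x) u ≢ 0 → u ∈ R × adj G x u ≡ true
    onlyDirty u ≢0 with x∈p∩q⁻ R _ (lookup-indicator-≢0 _ u ≢0)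
    ... | u∈R , u∈N = u∈R , ∈-tabulate⁻ u∈N

module FromZeroForcingSet {n} (G : Graph n) (S : Subset (numEdges G)) where
  open Edges G
  open Brushing G

  dirty : Subset n → Subset (numEdges G)
  dirty R = tabulate (λ k → lookup R (source k) ∧ lookup R (target k))

  ∈-dirty⁺ : ∀ {R k} → (∀ {z} → z ∈ᵉ k → z ∈ R) → k ∈ dirty R
  ∈-dirty⁺ ends∈R =
    ∈-tabulate⁺ (cong₂ _∧_ ([]=⇒lookup (ends∈R (inj₁ refl))) ([]=⇒lookup (ends∈R (inj₂ refl))))

  ∈-dirty⁻ : ∀ {R k z} → k ∈ dirty R → z ∈ᵉ k → z ∈ R
  ∈-dirty⁻ {R} k∈dirty (inj₁ refl) = lookup⇒[]= _ R (∧-conicalˡ _ _ (∈-tabulate⁻ k∈dirty))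
  ∈-dirty⁻ {R} k∈dirty (inj₂ refl) = lookup⇒[]= _ R (∧-conicalʳ _ _ (∈-tabulate⁻ k∈dirty))

  ∈-dirty-pair : ∀ {R k x y} → x ≢ y → x ∈ᵉ k → y ∈ᵉ k → x ∈ R → y ∈ R → k ∈ dirty R
  ∈-dirty-pair {R} x≢y xk yk x∈R y∈R = ∈-dirty⁺ λ zk →
    [ (λ z≡x → subst (_∈ R) (sym z≡x) x∈R) , (λ z≡y → subst (_∈ R) (sym z≡y) y∈R) ]
      (∈ᵉ-pair x≢y xk yk zk)

  dirty-─⊆ : ∀ R Q → dirty (R ─ Q) ⊆ dirty R
  dirty-─⊆ R Q k∈dirty = ∈-dirty⁺ λ zk → p─q⊆p R Q (∈-dirty⁻ k∈dirty zk)

  budget : Subset n → ℕ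
  budget R = ∣ S ∩ dirty R ∣

  firing-cost : ∀ {R x} {P : Subset n} → x ∈ R → P ⊆ R ∩ nbhd (adj G) x →
    (∀ {y k} → y ∈ P → x ∈ᵉ k → y ∈ᵉ k → k ∈ S) →
    ∣ P ∣ + budget (R - x) ≤ budget R
  firing-cost {R} {x} {P} x∈R P⊆N paid = begin
    ∣ P ∣ + budget (R - x)      ≤⟨ +-mono-≤ ∣P∣≤∣D─D′∣ budget≤∣D∩D′∣ ⟩
    ∣ D ─ D′ ∣ + ∣ D ∩ D′ ∣     ≡⟨ +-comm ∣ D ─ D′ ∣ _ ⟩
    ∣ D ∩ D′ ∣ + ∣ D ─ D′ ∣     ≡⟨ sym (∣p∣≡∣p∩q∣+∣p─q∣ D D′) ⟩
    budget R                    ∎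
    where
    open ≤-Reasoning
    D = S ∩ dirty R
    D′ = dirty (R - x)

    neighbour : ∀ {y} → y ∈ P → y ∈ R × adj G x y ≡ true
    neighbour y∈P with x∈p∩q⁻ R _ (P⊆N y∈P)
    ... | y∈R , y∈N = y∈R , ∈-tabulate⁻ y∈N

    cleaned : ∀ {y} → y ∈ P → ∃[ k ] k ∈ D ─ D′ × (x ∈ᵉ k × y ∈ᵉ k)
    cleaned y∈P with neighbour y∈P
    ... | y∈R , xy with adj⇒edge xy
    ...   | k , xk , yk =
      k , x∈p∧x∉q⇒x∈p─q (x∈p∩q⁺ (paid y∈P xk yk , ∈-dirty-pair (adj⇒≢ xy) xk yk x∈R y∈R))
                        (λ k∈D′ → x∉p-x R x (∈-dirty⁻ k∈D′ xk)) ,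
      xk , yk

    same-neighbour : ∀ {y y′ k} → y ∈ P → y′ ∈ P → x ∈ᵉ k × y ∈ᵉ k → x ∈ᵉ k × y′ ∈ᵉ k → y ≡ y′
    same-neighbour y∈P y′∈P (xk , yk) (_ , y′k)
      with ∈ᵉ-pair (adj⇒≢ (proj₂ (neighbour y∈P))) xk yk y′k
    ... | inj₁ y′≡x = ⊥-elim (adj⇒≢ (proj₂ (neighbour y′∈P)) (sym y′≡x))
    ... | inj₂ y′≡y = sym y′≡y

    ∣P∣≤∣D─D′∣ : ∣ P ∣ ≤ ∣ D ─ D′ ∣
    ∣P∣≤∣D─D′∣ = matching⇒∣p∣≤∣q∣ (λ y k → x ∈ᵉ k × y ∈ᵉ k) cleaned same-neighbour

    budget≤∣D∩D′∣ : budget (R - x) ≤ ∣ D ∩ D′ ∣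
    budget≤∣D∩D′∣ = p⊆q⇒∣p∣≤∣q∣ λ k∈ →
      let k∈S , k∈D′ = x∈p∩q⁻ S D′ k∈ in x∈p∩q⁺ (x∈p∩q⁺ (k∈S , dirty-─⊆ R ⁅ x ⁆ k∈D′) , k∈D′)

  Completable : Subset n → Vec ℕ n → Set
  Completable R b = Σ (Vec ℕ n) λ d → sum d ≤ budget R × Cleanable (R , b ⊕ d)

  fire-completable : ∀ {R b x} a → x ∈ R → dirtyDegree G R x ≤ lookup b x + a →
    a + budget (R - x) ≤ budget R →
    Completable (R - x) (b ⊕ spread R x) → Completable R b
  fire-completable {R} {b} {x} a x∈R deg≤ cost (d , sum-d≤ , cleanable) =
    d ⊕ single x a , sum≤ ,
    cleanable-◅ (fire-spread x∈R deg≤′)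
      (subst (λ c → Cleanable (R - x , c)) (⊕-rearrange b (spread R x) d (single x a))
             (cleanable-⊕ (single x a) cleanable))
    where
    open ≤-Reasoning

    sum≤ : sum (d ⊕ single x a) ≤ budget R
    sum≤ = begin
      sum (d ⊕ single x a)  ≡⟨ trans (sum-⊕ d (single x a)) (cong (sum d +_) (sum-single x a)) ⟩
      sum d + a             ≤⟨ +-monoˡ-≤ a sum-d≤ ⟩
      budget (R - x) + a    ≡⟨ +-comm (budget (R - x)) a ⟩
      a + budget (R - x)    ≤⟨ cost ⟩
      budget R              ∎

    deg≤′ : dirtyDegree G R x ≤ lookup (b ⊕ (d ⊕ single x a)) x
    deg≤′ = begin
      dirtyDegree G R x                       ≤⟨ deg≤ ⟩
      lookup b x + a                          ≤⟨ +-monoʳ-≤ (lookup b x) (m≤n+m a (lookup d x)) ⟩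
      lookup b x + (lookup d x + a)           ≡⟨ cong (λ s → lookup b x + (lookup d x + s))
                                                      (lookup∘update x (replicate _ 0) a) ⟨
      lookup b x + (lookup d x + lookup (single x a) x)
                                              ≡⟨ cong (lookup b x +_) (lookup-⊕ d (single x a) x) ⟨
      lookup b x + lookup (d ⊕ single x a) x  ≡⟨ lookup-⊕ b (d ⊕ single x a) x ⟨
      lookup (b ⊕ (d ⊕ single x a)) x         ∎

  record Invariant (Bk : Subset (numEdges G)) (R : Subset n) (b : Vec ℕ n) : Set where
    field
      dirtyBlack⊆S    : ∀ {k} → k ∈ Bk → k ∈ dirty R → k ∈ S
      frontierBrushed : ∀ {x y} → x ∈ R → y ∉ R → adj G x y ≡ true → 1 ≤ lookup b x
  open Invariant

  Surrounded : Subset (numEdges G) → Fin n → Set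
  Surrounded Bk v = ∀ k → v ∈ᵉ k → k ∈ Bk

  surrounded? : ∀ Bk v → Dec (Surrounded Bk v)
  surrounded? Bk v = all? λ k → ((v Fin.≟ source k) ⊎-dec (v Fin.≟ target k)) →-dec (k ∈? Bk)

  Swept : Subset (numEdges G) → Subset n → Set
  Swept Bk R = ∀ {v} → Surrounded Bk v → v ∉ R

  fire-preserves : ∀ {Bk R b x} → Invariant Bk R b → Invariant Bk (R - x) (b ⊕ spread R x)
  fire-preserves {R = R} {x = x} inv .dirtyBlack⊆S k∈Bk k∈dirty =
    inv .dirtyBlack⊆S k∈Bk (dirty-─⊆ R ⁅ x ⁆ k∈dirty)
  fire-preserves {R = R} {b} {x} inv .frontierBrushed {y} {z} y∈R-x z∉R-x yz with z Fin.≟ x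
  ... | yes refl = ≤-trans (≤-reflexive (sym (lookup-indicator-∈ y∈N))) (lookup≤lookup-⊕ʳ b (spread R z) y)
    where
    y∈N : y ∈ R ∩ nbhd (adj G) z
    y∈N = x∈p∩q⁺ (p─q⊆p R ⁅ z ⁆ y∈R-x , ∈-tabulate⁺ (trans (Graph.sym G z y) yz))
  ... | no z≢x =
    ≤-trans (inv .frontierBrushed (p─q⊆p R ⁅ x ⁆ y∈R-x) (λ z∈R → z∉R-x (x∈p∧x≢y⇒x∈p-y z∈R z≢x)) yz)
            (lookup≤lookup-⊕ˡ b (spread R x) y)

  blacken : ∀ {Bk R b f x} → Invariant Bk R b → x ∈ᵉ f → x ∉ R → Invariant (Bk ∪ ⁅ f ⁆) R b
  blacken {Bk} {f = f} inv xf x∉R .dirtyBlack⊆S k∈Bk∪f k∈dirty with x∈p∪q⁻ Bk ⁅ f ⁆ k∈Bk∪f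
  ... | inj₁ k∈Bk = inv .dirtyBlack⊆S k∈Bk k∈dirty
  ... | inj₂ k∈⁅f⁆ rewrite x∈⁅y⁆⇒x≡y f k∈⁅f⁆ = ⊥-elim (x∉R (∈-dirty⁻ k∈dirty xf))
  blacken inv _ _ .frontierBrushed = inv .frontierBrushed

  sweep : ∀ {Bk} → (∀ {R b} → Invariant Bk R b → Swept Bk R → Completable R b) →
    ∀ {R b} → Invariant Bk R b → Completable R b
  sweep {Bk} whenSwept = go (<-wellFounded _)
    where
    go : ∀ {R b} → Acc _<_ ∣ R ∣ → Invariant Bk R b → Completable R b
    go {R} (acc smaller) inv with any? (λ v → (v ∈? R) ×-dec surrounded? Bk v)
    ... | no none = whenSwept inv (λ {v} surr v∈R → none (v , v∈R , surr))
    ... | yes (v , v∈R , surr) =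
      fire-completable (dirtyDegree G R v) v∈R (m≤n+m _ _) (firing-cost v∈R (λ y∈N → y∈N) paid)
        (go (smaller (x∈p⇒∣p-x∣<∣p∣ v∈R)) (fire-preserves inv))
      where
      paid : ∀ {y k} → y ∈ R ∩ nbhd (adj G) v → v ∈ᵉ k → y ∈ᵉ k → k ∈ S
      paid y∈ vk yk with x∈p∩q⁻ R _ y∈
      ... | y∈R , y∈N =
        inv .dirtyBlack⊆S (surr _ vk) (∈-dirty-pair (adj⇒≢ (∈-tabulate⁻ y∈N)) vk yk v∈R y∈R)

  forced-black : ∀ {Bk e f z k} → e ∈ Bk → (∀ k → lineAdj G e k ≡ true → k ≢ f → k ∈ Bk) →
    z ∈ᵉ e → z ∈ᵉ k → k ≢ f → k ∈ Bk
  forced-black {e = e} {k = k} e∈Bk othersBlack ze zk k≢f with k Fin.≟ e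
  ... | yes refl = e∈Bk
  ... | no k≢e   = othersBlack k (⇒lineAdj (k≢e ∘ sym) ze zk) k≢f

  force-completable : ∀ {Bk Bk′} → ForceStep (lineAdj G) Bk Bk′ →
    (∀ {R b} → Invariant Bk′ R b → Completable R b) →
    ∀ {R b} → Invariant Bk R b → Swept Bk R → Completable R b
  force-completable {Bk} (e , f , e∈Bk , _ , eLf , othersBlack , refl) next {R} {b} inv swept
    with lineAdj⇒ eLf
  ... | e≢f , x , xe , xf with x ∈? R
  ...   | no x∉R  = next (blacken inv xf x∉R)
  ...   | yes x∈R with ∈ᵉ-other xe | ∈ᵉ-other xf
  ...     | u , ue , xu | w , wf , xw =
    fire-completable ∣ P ∣ x∈R deg≤ (firing-cost x∈R (p─q⊆p _ _) paid)
      (next (blacken (fire-preserves inv) xf (x∉p-x R x)))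
    where
    P = (R ∩ nbhd (adj G) x) - w

    u-surrounded : Surrounded Bk u
    u-surrounded k uk = forced-black e∈Bk othersBlack ue uk
      λ { refl → e≢f (edge-unique (adj⇒≢ xu ∘ sym) ue xe uk xf) }

    deg≤ : dirtyDegree G R x ≤ lookup b x + ∣ P ∣
    deg≤ = ≤-trans (∣p∣≤1+∣p-x∣ (R ∩ nbhd (adj G) x) w)
                   (+-monoˡ-≤ ∣ P ∣ (inv .frontierBrushed x∈R (swept u-surrounded) xu))

    paid : ∀ {y k} → y ∈ P → x ∈ᵉ k → y ∈ᵉ k → k ∈ S
    paid {y} {k} y∈P xk yk with x∈p∩q⁻ R _ (p─q⊆p _ _ y∈P)
    ... | y∈R , y∈N =
      inv .dirtyBlack⊆S (forced-black e∈Bk othersBlack xe xk k≢f) (∈-dirty-pair x≢y xk yk x∈R y∈R)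
      where
      x≢y = adj⇒≢ (∈-tabulate⁻ y∈N)

      k≢f : k ≢ f
      k≢f refl with ∈ᵉ-pair (adj⇒≢ xw) xf wf yk
      ... | inj₁ y≡x  = x≢y (sym y≡x)
      ... | inj₂ refl = x∉p-x (R ∩ nbhd (adj G) x) w y∈P

  complete : ∀ {Bk} → Star (ForceStep (lineAdj G)) Bk ⊤ →
    ∀ {R b} → Invariant Bk R b → Swept Bk R → Completable R b
  complete ε {R} {b} _ swept = subst (λ R → Completable R b) (sym R≡⊥) nothing-left
    where
    R≡⊥ : R ≡ ⊥
    R≡⊥ = Empty-unique λ (v , v∈R) → swept (λ _ _ → ∈⊤) v∈R

    nothing-left : Completable ⊥ b
    nothing-left = replicate n 0 , ≤-trans (≤-reflexive (sum-replicate-0 {n})) z≤n , _ , ε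
  complete (force ◅ forces) = force-completable force (sweep (complete forces))

  initialInvariant : Invariant S ⊤ (replicate n 0)
  initialInvariant .dirtyBlack⊆S k∈S _  = k∈S
  initialInvariant .frontierBrushed _ y∉⊤ _ = ⊥-elim (y∉⊤ ∈⊤)

  zeroForcingSet⇒cleaning : IsZeroForcingSet (lineAdj G) S →
    Σ (Vec ℕ n) λ c → Cleans G c × sum c ≤ ∣ S ∣
  zeroForcingSet⇒cleaning zf =
    let d , sum-d≤ , cleanable = sweep (complete zf) initialInvariant in
    d , subst (λ c → Cleanable (⊤ , c)) (zipWith-identityˡ +-identityˡ d) cleanable ,
    ≤-trans sum-d≤ (∣p∩q∣≤∣p∣ S (dirty ⊤))

theorem1 : ∀ (n : ℕ) (G : Graph n) → NoIsolatedVertices G →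
    ∀ (b z : ℕ) → IsBrushingNumber G b → IsZeroForcingNumber (lineAdj G) z →
    b ≤ z
theorem1 n G _ b z (_ , minimal) ((S , zf , ∣S∣≡z) , _) =
  let c , cleans , sum-c≤∣S∣ = FromZeroForcingSet.zeroForcingSet⇒cleaning G S zf in
  ≤-trans (minimal c cleans) (≤-trans sum-c≤∣S∣ (≤-reflexive ∣S∣≡z))
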